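{- Let $k \geq 1$ and let $G$ and $H$ be finite simple graphs with $\delta(H) \geq k$. Then $$\rho(G)\, \gamma_{\times k,t}(H) \leq \gamma_{\times k,t}(G\Box H).$$ Consequently, if in addition $\delta(G) \geq k$ and $\gamma_{\times k,t}(G) \leq 2k\rho(G)$, then $$\gamma_{\times k,t}(G)\, \gamma_{\times k,t}(H) \leq 2k\, \gamma_{\times k,t}(G\Box H).$$
   Context: All graphs are finite, undirected and simple; $N_G(v)$ is the open neighborhood, $N_G[v]=N_G(v)\cup\{v\}$ the closed neighborhood, and $\delta(G)$ the minimum degree. For $k\geq 1$, a set $S\subseteq V(G)$ is a $k$-tuple total dominating set if every vertex $v\in V(G)$ satisfies $|N_G(v)\cap S|\geq k$; such a set exists iff $\delta(G)\geq k$, and then $\gamma_{\times k,t}(G)$ denotes the minimum cardinality of such a set. A packing of $G$ is a set of vertices whose closed neighborhoods are pairwise disjoint; $\rho(G)$ is the maximum cardinality of a packing. The Cartesian product $G\Box H$ has vertex set $V(G)\times V(H)$, with $(u_1,v_1)$ adjacent to $(u_2,v_2)$ iff either $u_1=u_2$ and $v_1v_2\in E(H)$, or $v_1=v_2$ and $u_1u_2\in E(G)$. -}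

module Defs where

open import Data.Nat using (ℕ; _≤_; _*_)
open import Data.Bool using (Bool; true; false; _∨_; _∧_; T)
open import Data.Fin using (Fin; remQuot; _≟_)
open import Data.Fin.Subset using (Subset; _∈_; _∩_; ∣_∣)
open import Data.Vec using (tabulate)
open import Data.Product using (_×_; proj₁; proj₂)
open import Relation.Binary.PropositionalEquality as Eq using (_≡_; _≢_; refl)
open import Data.Empty using (⊥-elim)
open import Relation.Nullary using (¬_; yes; no)
open import Relation.Nullary.Decidable using (⌊_⌋)

record Graph : Set where
  field
    n     : ℕ
    adj   : Fin n → Fin n → Bool
    sym   : ∀ u v → adj u v ≡ adj v u
    irrefl : ∀ v → adj v v ≡ false
open Graph public

N : (G : Graph) → Fin (n G) → Subset (n G)
N G v = tabulate (adj G v)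

N[_] : (G : Graph) → Fin (n G) → Subset (n G)
N[ G ] v = tabulate (λ u → adj G v u ∨ ⌊ u ≟ v ⌋)

MinDegreeAtLeast : Graph → ℕ → Set
MinDegreeAtLeast G k = ∀ v → k ≤ ∣ N G v ∣

IsKTupleTDS : (G : Graph) → ℕ → Subset (n G) → Set
IsKTupleTDS G k S = ∀ v → k ≤ ∣ N G v ∩ S ∣

IsKTupleTotalDomNumber : (G : Graph) → ℕ → ℕ → Set
IsKTupleTotalDomNumber G k m =
  (Data.Product.Σ (Subset (n G)) λ S → IsKTupleTDS G k S × ∣ S ∣ ≡ m)
  × (∀ S → IsKTupleTDS G k S → m ≤ ∣ S ∣)

IsPacking : (G : Graph) → Subset (n G) → Set
IsPacking G P = ∀ u v → u ∈ P → v ∈ P → u ≢ v →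
  ∀ w → ¬ (w ∈ N[ G ] u × w ∈ N[ G ] v)

IsPackingNumber : (G : Graph) → ℕ → Set
IsPackingNumber G m =
  (Data.Product.Σ (Subset (n G)) λ P → IsPacking G P × ∣ P ∣ ≡ m)
  × (∀ P → IsPacking G P → ∣ P ∣ ≤ m)

-- Cartesian product G □ H on Fin (n G * n H); vertex i corresponds to the
-- pair remQuot (n H) i = (g , h).
□adj : (G H : Graph) → Fin (n G * n H) → Fin (n G * n H) → Bool
□adj G H x y =
  let g₁ = proj₁ (remQuot {n G} (n H) x) ; h₁ = proj₂ (remQuot {n G} (n H) x)
      g₂ = proj₁ (remQuot {n G} (n H) y) ; h₂ = proj₂ (remQuot {n G} (n H) y)
  in (⌊ g₁ ≟ g₂ ⌋ ∧ adj H h₁ h₂) ∨ (⌊ h₁ ≟ h₂ ⌋ ∧ adj G g₁ g₂)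

private
  ≟-sym : ∀ {m} (a b : Fin m) → ⌊ a ≟ b ⌋ ≡ ⌊ b ≟ a ⌋
  ≟-sym a b with a ≟ b | b ≟ a
  ... | yes _ | yes _ = refl
  ... | no  _ | no  _ = refl
  ... | yes p | no ¬q = ⊥-elim (¬q (Eq.sym p))
  ... | no ¬p | yes q = ⊥-elim (¬p (Eq.sym q))

  ≟-refl : ∀ {m} (a : Fin m) → ⌊ a ≟ a ⌋ ≡ true
  ≟-refl a with a ≟ a
  ... | yes _ = refl
  ... | no ¬p = ⊥-elim (¬p refl)

_□_ : Graph → Graph → Graph
G □ H = record
  { n = n G * n H
  ; adj = □adj G H
  ; sym = λ x y →
      let g₁ = proj₁ (remQuot {n G} (n H) x) ; h₁ = proj₂ (remQuot {n G} (n H) x)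
          g₂ = proj₁ (remQuot {n G} (n H) y) ; h₂ = proj₂ (remQuot {n G} (n H) y)
      in Eq.cong₂ _∨_ (Eq.cong₂ _∧_ (≟-sym g₁ g₂) (Graph.sym H h₁ h₂))
                      (Eq.cong₂ _∧_ (≟-sym h₁ h₂) (Graph.sym G g₁ g₂))
  ; irrefl = λ x →
      let g = proj₁ (remQuot {n G} (n H) x) ; h = proj₂ (remQuot {n G} (n H) x)
      in Eq.trans (Eq.cong₂ _∨_ (Eq.cong₂ _∧_ (≟-refl g) (irrefl H h))
                                 (Eq.cong₂ _∧_ (≟-refl h) (irrefl G g))) refl
  }

-- Fix a k-tuple total dominating set S of G □ H and a vertex u of G. Every
-- (u , h) has k neighbours in S, lying either in the fibre S_u = {h′ ∣ (u , h′) ∈ S}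
-- next to h, or in the copies of h over the G-neighbours g of u. Topping S_u up
-- inside N_H(h) by the latter number, for every h, makes it a k-tuple total
-- dominating set of H, so γ(H) is at most the number of vertices of S lying
-- over N_G[u]. For a packing P these sets N_G[u] × V(H), u ∈ P, are disjoint,
-- hence ρ(G) γ(H) ≤ |S|.
module Submission where

open import Defs
open import Data.Nat using (ℕ; zero; suc; _+_; _*_; _∸_; _≤_; _<_; _≥_; z≤n; s≤s; _≤?_)
open import Data.Nat.Properties
  using ( +-*-semiring; +-assoc; +-suc; +-identityʳ; +-mono-≤; +-monoˡ-≤; +-monoʳ-≤
        ; *-assoc; *-monoˡ-≤; *-monoʳ-≤; +-comm; ≤-refl; ≤-reflexive; ≤-trans; <-≤-trans; ≰⇒>
        ; m≤m+n; n≤1+n; m≤n+m∸n; m≤n+o⇒m∸n≤o; ∸-monoʳ-≤; module ≤-Reasoning )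
open import Algebra.Properties.Semiring.Sum +-*-semiring
  using (sum; sum-syntax; sum-cong-≗; sum-replicate-zero; ∑-comm; ∑-distrib-+; *-distribʳ-sum)
open import Data.Bool using (Bool; true; false; _∧_; _∨_)
open import Data.Bool.Properties using (∧-assoc; ∧-comm; ∧-distribʳ-∨; ∨-identityʳ)
open import Data.Fin using (Fin; zero; suc; combine; quotient; _↑ˡ_; _↑ʳ_)
open import Data.Fin.Properties using (_≟_; remQuot-combine; suc-injective; 0≢1+n)
open import Data.Fin.Subset using (Subset; inside; outside; _∈_; _∉_; _⊆_; _⊂_; _∩_; _∪_; ⁅_⁆; ∣_∣)
open import Data.Fin.Subset.Properties
  using (p⊆q⇒∣p∣≤∣q∣; p⊂q⇒∣p∣<∣q∣; x∈p∩q⁺; x∈p∩q⁻; p⊆p∪q; x∈p∪q⁺; x∈⁅x⁆; ∣⁅x⁆∣≡1)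
open import Data.Vec using ([]; _∷_; here; there; lookup; tabulate)
open import Data.Vec.Properties using (lookup∘tabulate; lookup-zipWith; lookup⇒[]=)
open import Data.Product using (_×_; _,_; proj₁; proj₂; ∃-syntax)
open import Data.Sum using (inj₂)
open import Data.Empty using (⊥-elim)
open import Function using (_∘_; id)
open import Relation.Nullary using (yes; no)
open import Relation.Nullary.Decidable using (⌊_⌋; decidable-stable)
open import Relation.Binary.PropositionalEquality as ≡
  using (_≡_; _≢_; refl; cong; cong₂; subst₂; module ≡-Reasoning)

∑-mono-≤ : ∀ {m} {f g : Fin m → ℕ} → (∀ i → f i ≤ g i) → sum f ≤ sum g
∑-mono-≤ {zero}  _   = z≤n
∑-mono-≤ {suc m} f≤g = +-mono-≤ (f≤g zero) (∑-mono-≤ (f≤g ∘ suc))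

∑-↑ : ∀ {m n} (f : Fin (m + n) → ℕ) →
      sum f ≡ ∑[ i < m ] f (i ↑ˡ n) + ∑[ j < n ] f (m ↑ʳ j)
∑-↑ {zero}  f = refl
∑-↑ {suc m} {n} f = ≡.trans (cong (f zero +_) (∑-↑ {m} {n} (f ∘ suc))) (≡.sym (+-assoc (f zero) _ _))

∑-combine : ∀ {m n} (f : Fin (m * n) → ℕ) → sum f ≡ ∑[ i < m ] ∑[ j < n ] f (combine i j)
∑-combine {zero}      f = refl
∑-combine {suc m} {n} f =
  ≡.trans (∑-↑ {n} {m * n} f) (cong (sum (λ j → f (j ↑ˡ m * n)) +_) (∑-combine {m} {n} (f ∘ (n ↑ʳ_))))

∑∑-distrib-+ : ∀ {m n} (f g : Fin m → Fin n → ℕ) →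
  ∑[ i < m ] ∑[ j < n ] (f i j + g i j) ≡ ∑[ i < m ] ∑[ j < n ] f i j + ∑[ i < m ] ∑[ j < n ] g i j
∑∑-distrib-+ f g =
  ≡.trans (sum-cong-≗ (λ i → ∑-distrib-+ (f i) (g i))) (∑-distrib-+ (sum ∘ f) (sum ∘ g))

𝟙 : Bool → ℕ
𝟙 true  = 1
𝟙 false = 0

𝟙-∨ : ∀ a b → 𝟙 (a ∨ b) ≤ 𝟙 a + 𝟙 b
𝟙-∨ false b     = ≤-refl
𝟙-∨ true  false = ≤-refl
𝟙-∨ true  true  = s≤s z≤n

count : ∀ {m} → (Fin m → Bool) → ℕ
count f = sum (𝟙 ∘ f)

⌊suc≟suc⌋ : ∀ {m} (i j : Fin m) → ⌊ suc i ≟ suc j ⌋ ≡ ⌊ i ≟ j ⌋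
⌊suc≟suc⌋ i j with i ≟ j
... | yes _ = refl
... | no  _ = refl

count-δ : ∀ {m} (i : Fin m) (f : Fin m → Bool) → count (λ j → ⌊ i ≟ j ⌋ ∧ f j) ≡ 𝟙 (f i)
count-δ {suc m} zero    f = ≡.trans (cong (𝟙 (f zero) +_) (sum-replicate-zero m)) (+-identityʳ _)
count-δ {suc m} (suc i) f =
  ≡.trans (sum-cong-≗ λ j → cong (λ b → 𝟙 (b ∧ f (suc j))) (⌊suc≟suc⌋ i j)) (count-δ i (f ∘ suc))

count-δ′ : ∀ {m} (i : Fin m) (f : Fin m → Bool) → count (λ j → ⌊ j ≟ i ⌋ ∧ f j) ≡ 𝟙 (f i)
count-δ′ {suc m} zero    f = ≡.trans (cong (𝟙 (f zero) +_) (sum-replicate-zero m)) (+-identityʳ _)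
count-δ′ {suc m} (suc i) f =
  ≡.trans (sum-cong-≗ λ j → cong (λ b → 𝟙 (b ∧ f (suc j))) (⌊suc≟suc⌋ j i)) (count-δ′ i (f ∘ suc))

count-none : ∀ {m} (f : Fin m → Bool) → (∀ i → f i ≢ true) → count f ≡ 0
count-none {zero}  f none = refl
count-none {suc m} f none with f zero in f₀
... | true with () ← none zero f₀
... | false = count-none (f ∘ suc) (none ∘ suc)

count-≤1 : ∀ {m} (f : Fin m → Bool) → (∀ i j → f i ≡ true → f j ≡ true → i ≡ j) → count f ≤ 1
count-≤1 {zero}  f unique = z≤n
count-≤1 {suc m} f unique with f zero in f₀
... | false = count-≤1 (f ∘ suc) (λ i j fi fj → suc-injective (unique (suc i) (suc j) fi fj))
... | true  = s≤s (≤-reflexive (count-none (f ∘ suc) λ i fi → 0≢1+n (unique zero (suc i) f₀ fi)))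

∣p∣≡count : ∀ {m} (p : Subset m) → ∣ p ∣ ≡ count (lookup p)
∣p∣≡count []            = refl
∣p∣≡count (inside  ∷ p) = cong suc (∣p∣≡count p)
∣p∣≡count (outside ∷ p) = ∣p∣≡count p

∣tabulate∣ : ∀ {m} (f : Fin m → Bool) → ∣ tabulate f ∣ ≡ count f
∣tabulate∣ f = ≡.trans (∣p∣≡count (tabulate f)) (sum-cong-≗ (cong 𝟙 ∘ lookup∘tabulate f))

∣tabulate∩∣ : ∀ {m} (f : Fin m → Bool) (q : Subset m) → ∣ tabulate f ∩ q ∣ ≡ count (λ i → f i ∧ lookup q i)
∣tabulate∩∣ f q = ≡.trans (∣p∣≡count (tabulate f ∩ q)) (sum-cong-≗ λ i →
  cong 𝟙 (≡.trans (lookup-zipWith _∧_ i (tabulate f) q) (cong (_∧ lookup q i) (lookup∘tabulate f i))))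

∑-count-disjoint : ∀ {m N} (F : Fin m → Fin N → Bool) (s : Fin N → Bool) →
  (∀ x u v → F u x ≡ true → F v x ≡ true → u ≡ v) →
  ∑[ u < m ] count (λ x → s x ∧ F u x) ≤ count s
∑-count-disjoint {m} F s disjoint = begin
  ∑[ u < m ] count (λ x → s x ∧ F u x) ≡⟨ ∑-comm (λ u x → 𝟙 (s x ∧ F u x)) ⟩
  sum (λ x → count (λ u → s x ∧ F u x)) ≤⟨ ∑-mono-≤ (λ x → atMostOne x (s x)) ⟩
  count s                              ∎
  where
  open ≤-Reasoning
  atMostOne : ∀ x b → count (λ u → b ∧ F u x) ≤ 𝟙 b
  atMostOne x false = ≤-reflexive (sum-replicate-zero m)
  atMostOne x true  = count-≤1 (λ u → F u x) (disjoint x)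

∣p∪q∣≤∣p∣+∣q∣ : ∀ {m} (p q : Subset m) → ∣ p ∪ q ∣ ≤ ∣ p ∣ + ∣ q ∣
∣p∪q∣≤∣p∣+∣q∣ []            []            = z≤n
∣p∪q∣≤∣p∣+∣q∣ (outside ∷ p) (outside ∷ q) = ∣p∪q∣≤∣p∣+∣q∣ p q
∣p∪q∣≤∣p∣+∣q∣ (outside ∷ p) (inside  ∷ q) = ≤-trans (s≤s (∣p∪q∣≤∣p∣+∣q∣ p q)) (≤-reflexive (≡.sym (+-suc _ _)))
∣p∪q∣≤∣p∣+∣q∣ (inside  ∷ p) (outside ∷ q) = s≤s (∣p∪q∣≤∣p∣+∣q∣ p q)
∣p∪q∣≤∣p∣+∣q∣ (inside  ∷ p) (inside  ∷ q) = s≤s (≤-trans (∣p∪q∣≤∣p∣+∣q∣ p q) (+-monoʳ-≤ ∣ p ∣ (n≤1+n ∣ q ∣)))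

∣p∩q∣<∣p∣⇒∈p∉q : ∀ {m} (p q : Subset m) → ∣ p ∩ q ∣ < ∣ p ∣ → ∃[ x ] x ∈ p × x ∉ q
∣p∩q∣<∣p∣⇒∈p∉q (inside  ∷ p) (outside ∷ q) _ = zero , here , λ ()
∣p∩q∣<∣p∣⇒∈p∉q (inside  ∷ p) (inside  ∷ q) (s≤s lt) with ∣p∩q∣<∣p∣⇒∈p∉q p q lt
... | x , x∈p , x∉q = suc x , there x∈p , λ { (there x∈q) → x∉q x∈q }
∣p∩q∣<∣p∣⇒∈p∉q (outside ∷ p) (_ ∷ q) lt with ∣p∩q∣<∣p∣⇒∈p∉q p q lt
... | x , x∈p , x∉q = suc x , there x∈p , λ { (there x∈q) → x∉q x∈q }

∩-monoʳ-⊆ : ∀ {m} (r : Subset m) {p q : Subset m} → p ⊆ q → r ∩ p ⊆ r ∩ q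
∩-monoʳ-⊆ r {p} p⊆q x∈r∩p = let x∈r , x∈p = x∈p∩q⁻ r p x∈r∩p in x∈p∩q⁺ (x∈r , p⊆q x∈p)

-- Augmenting a set until it meets every set of a family k times

module _ {n k : ℕ} (A : Fin n → Subset n) (k≤∣A∣ : ∀ v → k ≤ ∣ A v ∣) where

  add-missing : ∀ v T → ∣ A v ∩ T ∣ < k →
    ∃[ T′ ] T ⊆ T′ × suc ∣ A v ∩ T ∣ ≤ ∣ A v ∩ T′ ∣ × ∣ T′ ∣ ≤ suc ∣ T ∣
  add-missing v T ∣A∩T∣<k with ∣p∩q∣<∣p∣⇒∈p∉q (A v) T (<-≤-trans ∣A∩T∣<k (k≤∣A∣ v))
  ... | w , w∈A , w∉T = T ∪ ⁅ w ⁆ , T⊆T′ , p⊂q⇒∣p∣<∣q∣ A∩T⊂A∩T′ , ∣T′∣≤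
    where
    T⊆T′ : T ⊆ T ∪ ⁅ w ⁆
    T⊆T′ = p⊆p∪q ⁅ w ⁆
    A∩T⊂A∩T′ : A v ∩ T ⊂ A v ∩ (T ∪ ⁅ w ⁆)
    A∩T⊂A∩T′ = ∩-monoʳ-⊆ (A v) T⊆T′ , w ,
      x∈p∩q⁺ (w∈A , x∈p∪q⁺ (inj₂ (x∈⁅x⁆ w))) , w∉T ∘ proj₂ ∘ x∈p∩q⁻ (A v) T
    ∣T′∣≤ : ∣ T ∪ ⁅ w ⁆ ∣ ≤ suc ∣ T ∣
    ∣T′∣≤ = ≤-trans (∣p∪q∣≤∣p∣+∣q∣ T ⁅ w ⁆)
              (≤-reflexive (≡.trans (cong (∣ T ∣ +_) (∣⁅x⁆∣≡1 w)) (+-comm ∣ T ∣ 1)))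

  saturate : ∀ v m T → k ≤ ∣ A v ∩ T ∣ + m →
    ∃[ T′ ] T ⊆ T′ × k ≤ ∣ A v ∩ T′ ∣ × ∣ T′ ∣ ≤ ∣ T ∣ + m
  saturate v m T k≤ with k ≤? ∣ A v ∩ T ∣
  ... | yes k≤∣A∩T∣ = T , id , k≤∣A∩T∣ , m≤m+n ∣ T ∣ m
  saturate v zero    T k≤ | no k≰∣A∩T∣ = ⊥-elim (k≰∣A∩T∣ (≤-trans k≤ (≤-reflexive (+-identityʳ _))))
  saturate v (suc m) T k≤ | no k≰∣A∩T∣ with add-missing v T (≰⇒> k≰∣A∩T∣)
  ... | T₁ , T⊆T₁ , grows , ∣T₁∣≤ with saturate v m T₁ (≤-trans k≤ (≤-trans (≤-reflexive (+-suc _ m)) (+-monoˡ-≤ m grows)))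
  ... | T′ , T₁⊆T′ , sat , ∣T′∣≤ =
    T′ , T₁⊆T′ ∘ T⊆T₁ , sat , ≤-trans ∣T′∣≤ (≤-trans (+-monoˡ-≤ m ∣T₁∣≤) (≤-reflexive (≡.sym (+-suc ∣ T ∣ m))))

  deficiency : Subset n → Fin n → ℕ
  deficiency T v = k ∸ ∣ A v ∩ T ∣

  saturate-all : ∀ {m} (vs : Fin m → Fin n) T →
    ∃[ D ] T ⊆ D × (∀ j → k ≤ ∣ A (vs j) ∩ D ∣) × ∣ D ∣ ≤ ∣ T ∣ + ∑[ j < m ] deficiency T (vs j)
  saturate-all {zero}  vs T = T , id , (λ ()) , m≤m+n ∣ T ∣ 0
  saturate-all {suc m} vs T
    with saturate (vs zero) (deficiency T (vs zero)) T (m≤n+m∸n k ∣ A (vs zero) ∩ T ∣)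
  ... | T₁ , T⊆T₁ , sat₀ , ∣T₁∣≤ with saturate-all (vs ∘ suc) T₁
  ... | D , T₁⊆D , sat , ∣D∣≤ =
    D , T₁⊆D ∘ T⊆T₁ , (λ { zero → ≤-trans sat₀ (p⊆q⇒∣p∣≤∣q∣ (∩-monoʳ-⊆ (A (vs zero)) T₁⊆D)) ; (suc j) → sat j }) ,
    ≤-trans ∣D∣≤ (≤-trans (+-mono-≤ ∣T₁∣≤ (∑-mono-≤ deficiency-shrinks)) (≤-reflexive (+-assoc ∣ T ∣ _ _)))
    where
    deficiency-shrinks : ∀ j → deficiency T₁ (vs (suc j)) ≤ deficiency T (vs (suc j))
    deficiency-shrinks j = ∸-monoʳ-≤ k (p⊆q⇒∣p∣≤∣q∣ (∩-monoʳ-⊆ (A (vs (suc j))) T⊆T₁))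

  augment : ∀ T (b : Fin n → ℕ) → (∀ v → k ≤ ∣ A v ∩ T ∣ + b v) →
    ∃[ D ] (∀ v → k ≤ ∣ A v ∩ D ∣) × ∣ D ∣ ≤ ∣ T ∣ + sum b
  augment T b k≤ with saturate-all id T
  ... | D , _ , sat , ∣D∣≤ =
    D , sat , ≤-trans ∣D∣≤ (+-monoʳ-≤ ∣ T ∣ (∑-mono-≤ λ v → m≤n+o⇒m∸n≤o k _ (k≤ v)))

𝟙-∨-∧ : ∀ a b c d e → 𝟙 (((a ∧ b) ∨ (c ∧ d)) ∧ e) ≤ 𝟙 (a ∧ (b ∧ e)) + 𝟙 (c ∧ (d ∧ e))
𝟙-∨-∧ a b c d e rewrite ∧-distribʳ-∨ e (a ∧ b) (c ∧ d) | ∧-assoc a b e | ∧-assoc c d e =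
  𝟙-∨ (a ∧ (b ∧ e)) (c ∧ (d ∧ e))

𝟙-closedNbhd : ∀ (G : Graph) u g b →
  𝟙 (⌊ g ≟ u ⌋ ∧ b) + 𝟙 (adj G u g ∧ b) ≡ 𝟙 (b ∧ lookup (N[ G ] u) g)
𝟙-closedNbhd G u g b rewrite lookup∘tabulate (λ w → adj G u w ∨ ⌊ w ≟ u ⌋) g with g ≟ u
... | yes refl rewrite irrefl G g = centre b
  where
  centre : ∀ b → 𝟙 b + 0 ≡ 𝟙 (b ∧ true)
  centre true  = refl
  centre false = refl
... | no _ = cong 𝟙 (≡.trans (∧-comm (adj G u g) b) (cong (b ∧_) (≡.sym (∨-identityʳ (adj G u g)))))

□adj-combine : ∀ (G H : Graph) u h g h′ →
  adj (G □ H) (combine u h) (combine g h′) ≡ (⌊ u ≟ g ⌋ ∧ adj H h h′) ∨ (⌊ h ≟ h′ ⌋ ∧ adj G u g)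
□adj-combine G H u h g h′ =
  cong₂ (λ (x y : Fin (n G) × Fin (n H)) → (⌊ proj₁ x ≟ proj₁ y ⌋ ∧ adj H (proj₂ x) (proj₂ y))
                                         ∨ (⌊ proj₂ x ≟ proj₂ y ⌋ ∧ adj G (proj₁ x) (proj₁ y)))
        (remQuot-combine u h) (remQuot-combine g h′)

∧-true : ∀ {a b} → a ∧ b ≡ true → a ≡ true × b ≡ true
∧-true {true} b≡true = refl , b≡true

packing-unique : ∀ (G : Graph) {P} → IsPacking G P →
  ∀ {u v g} → u ∈ P → v ∈ P → g ∈ N[ G ] u → g ∈ N[ G ] v → u ≡ v
packing-unique G packing {u} {v} {g} u∈P v∈P g∈N[u] g∈N[v] =
  decidable-stable (u ≟ v) λ u≢v → packing u v u∈P v∈P u≢v g (g∈N[u] , g∈N[v])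

module _ (G H : Graph) (S : Subset (n G * n H)) where

  private
    s : Fin (n G) → Fin (n H) → Bool
    s g h = lookup S (combine g h)

  fibre : Fin (n G) → Subset (n H)
  fibre u = tabulate (s u)

  degreeᴳ : Fin (n G) → Fin (n H) → ℕ
  degreeᴳ u h = count (λ g → adj G u g ∧ s g h)

  over-N[_] : Fin (n G) → Fin (n G * n H) → Bool
  over-N[ u ] x = lookup (N[ G ] u) (quotient (n H) x)

  ∣N□∩S∣≤ : ∀ u h → ∣ N (G □ H) (combine u h) ∩ S ∣ ≤ ∣ N H h ∩ fibre u ∣ + degreeᴳ u h
  ∣N□∩S∣≤ u h = begin
    ∣ N (G □ H) x ∩ S ∣
      ≡⟨ ∣tabulate∩∣ (adj (G □ H) x) S ⟩
    count (λ y → adj (G □ H) x y ∧ lookup S y)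
      ≡⟨ ∑-combine {n G} {n H} _ ⟩
    ∑[ g < n G ] ∑[ h′ < n H ] 𝟙 (adj (G □ H) x (combine g h′) ∧ s g h′)
      ≤⟨ ∑-mono-≤ (λ g → ∑-mono-≤ λ h′ → split g h′) ⟩
    ∑[ g < n G ] ∑[ h′ < n H ] (alongH g h′ + alongG g h′)
      ≡⟨ ∑∑-distrib-+ alongH alongG ⟩
    ∑[ g < n G ] ∑[ h′ < n H ] alongH g h′ + ∑[ g < n G ] ∑[ h′ < n H ] alongG g h′
      ≡⟨ cong₂ _+_ (≡.trans (∑-comm alongH) (sum-cong-≗ λ h′ → count-δ u (λ g → adj H h h′ ∧ s g h′)))
                   (sum-cong-≗ λ g → count-δ h (λ h′ → adj G u g ∧ s g h′)) ⟩
    count (λ h′ → adj H h h′ ∧ s u h′) + degreeᴳ u h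
      ≡⟨ cong (_+ degreeᴳ u h) (≡.sym (≡.trans (∣tabulate∩∣ (adj H h) (fibre u)) (sum-cong-≗ λ h′ →
           cong (λ b → 𝟙 (adj H h h′ ∧ b)) (lookup∘tabulate (s u) h′)))) ⟩
    ∣ N H h ∩ fibre u ∣ + degreeᴳ u h ∎
    where
    open ≤-Reasoning
    x : Fin (n G * n H)
    x = combine u h
    alongH alongG : Fin (n G) → Fin (n H) → ℕ
    alongH g h′ = 𝟙 (⌊ u ≟ g ⌋ ∧ (adj H h h′ ∧ s g h′))
    alongG g h′ = 𝟙 (⌊ h ≟ h′ ⌋ ∧ (adj G u g ∧ s g h′))
    split : ∀ g h′ → 𝟙 (adj (G □ H) x (combine g h′) ∧ s g h′) ≤ alongH g h′ + alongG g h′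
    split g h′ rewrite □adj-combine G H u h g h′ = 𝟙-∨-∧ ⌊ u ≟ g ⌋ (adj H h h′) ⌊ h ≟ h′ ⌋ (adj G u g) (s g h′)

  ∣fibre∣+∑degreeᴳ : ∀ u →
    ∣ fibre u ∣ + sum (degreeᴳ u)
      ≡ count (λ x → lookup S x ∧ over-N[ u ] x)
  ∣fibre∣+∑degreeᴳ u = begin
    ∣ fibre u ∣ + sum (degreeᴳ u)
      ≡⟨ cong (_+ sum (degreeᴳ u))
              (≡.trans (∣tabulate∣ (s u)) (sum-cong-≗ λ h → ≡.sym (count-δ′ u (λ g → s g h)))) ⟩
    ∑[ h < n H ] ∑[ g < n G ] 𝟙 (⌊ g ≟ u ⌋ ∧ s g h) + ∑[ h < n H ] ∑[ g < n G ] 𝟙 (adj G u g ∧ s g h)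
      ≡⟨ ≡.sym (∑∑-distrib-+ (λ h g → 𝟙 (⌊ g ≟ u ⌋ ∧ s g h)) (λ h g → 𝟙 (adj G u g ∧ s g h))) ⟩
    ∑[ h < n H ] ∑[ g < n G ] (𝟙 (⌊ g ≟ u ⌋ ∧ s g h) + 𝟙 (adj G u g ∧ s g h))
      ≡⟨ sum-cong-≗ (λ h → sum-cong-≗ λ g → 𝟙-closedNbhd G u g (s g h)) ⟩
    ∑[ h < n H ] ∑[ g < n G ] 𝟙 (s g h ∧ lookup (N[ G ] u) g)
      ≡⟨ ∑-comm (λ h g → 𝟙 (s g h ∧ lookup (N[ G ] u) g)) ⟩
    ∑[ g < n G ] ∑[ h < n H ] 𝟙 (s g h ∧ lookup (N[ G ] u) g)
      ≡⟨ sum-cong-≗ (λ g → sum-cong-≗ λ h → cong (λ g′ → 𝟙 (s g h ∧ lookup (N[ G ] u) g′))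
           (≡.sym (cong proj₁ (remQuot-combine {n G} {n H} g h)))) ⟩
    ∑[ g < n G ] ∑[ h < n H ] 𝟙 (s g h ∧ over-N[ u ] (combine g h))
      ≡⟨ ≡.sym (∑-combine {n G} {n H} λ x → 𝟙 (lookup S x ∧ over-N[ u ] x)) ⟩
    count (λ x → lookup S x ∧ over-N[ u ] x) ∎
    where open ≡-Reasoning

  γ≤∣S-over-N[u]∣ : ∀ {k γH} → IsKTupleTDS (G □ H) k S → MinDegreeAtLeast H k →
    (∀ D → IsKTupleTDS H k D → γH ≤ ∣ D ∣) →
    ∀ u → γH ≤ count (λ x → lookup S x ∧ over-N[ u ] x)
  γ≤∣S-over-N[u]∣ {k} {γH} S-dominates δH≥k γH-minimal u with
    augment (N H) δH≥k (fibre u) (degreeᴳ u) (λ h → ≤-trans (S-dominates (combine u h)) (∣N□∩S∣≤ u h))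
  ... | D , D-dominates , ∣D∣≤ = begin
    γH                                                                  ≤⟨ γH-minimal D D-dominates ⟩
    ∣ D ∣                                                               ≤⟨ ∣D∣≤ ⟩
    ∣ fibre u ∣ + sum (degreeᴳ u)                                       ≡⟨ ∣fibre∣+∑degreeᴳ u ⟩
    count (λ x → lookup S x ∧ over-N[ u ] x) ∎
    where open ≤-Reasoning

  packing*γ≤∣S∣ : ∀ {k γH P} → IsKTupleTDS (G □ H) k S → MinDegreeAtLeast H k →
    (∀ D → IsKTupleTDS H k D → γH ≤ ∣ D ∣) → IsPacking G P → ∣ P ∣ * γH ≤ ∣ S ∣
  packing*γ≤∣S∣ {k} {γH} {P} S-dominates δH≥k γH-minimal packing = begin
    ∣ P ∣ * γH                                      ≡⟨ cong (_* γH) (∣p∣≡count P) ⟩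
    count (lookup P) * γH                           ≡⟨ *-distribʳ-sum γH (𝟙 ∘ lookup P) ⟩
    ∑[ u < n G ] (𝟙 (lookup P u) * γH)              ≤⟨ ∑-mono-≤ (λ u → bound u (lookup P u)) ⟩
    ∑[ u < n G ] count (λ x → lookup S x ∧ over u x) ≤⟨ ∑-count-disjoint over (lookup S) disjoint ⟩
    count (lookup S)                                ≡⟨ ≡.sym (∣p∣≡count S) ⟩
    ∣ S ∣                                           ∎
    where
    open ≤-Reasoning
    over : Fin (n G) → Fin (n G * n H) → Bool
    over u x = lookup P u ∧ over-N[ u ] x
    bound : ∀ u b → 𝟙 b * γH ≤ count (λ x → lookup S x ∧ (b ∧ over-N[ u ] x))
    bound u false = z≤n
    bound u true  = ≤-trans (≤-reflexive (+-identityʳ γH)) (γ≤∣S-over-N[u]∣ S-dominates δH≥k γH-minimal u)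
    disjoint : ∀ x u v → over u x ≡ true → over v x ≡ true → u ≡ v
    disjoint x u v over-u over-v with ∧-true {lookup P u} over-u | ∧-true {lookup P v} over-v
    ... | u∈P , g∈N[u] | v∈P , g∈N[v] = packing-unique G packing
      (lookup⇒[]= u P u∈P) (lookup⇒[]= v P v∈P)
      (lookup⇒[]= _ (N[ G ] u) g∈N[u]) (lookup⇒[]= _ (N[ G ] v) g∈N[v])

theorem1 : (k : ℕ) → k ≥ 1 → (G H : Graph) → MinDegreeAtLeast H k →
    (ρG γH γGH : ℕ) →
    IsPackingNumber G ρG →
    IsKTupleTotalDomNumber H k γH →
    IsKTupleTotalDomNumber (G □ H) k γGH →
    (ρG * γH ≤ γGH)
    × ((γG : ℕ) → MinDegreeAtLeast G k → IsKTupleTotalDomNumber G k γG →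
       γG ≤ 2 * k * ρG → γG * γH ≤ 2 * k * γGH)
theorem1 k _ G H δH≥k ρG γH γGH ((P , packing , ∣P∣≡ρG) , _) (_ , γH-minimal) ((S , S-dominates , ∣S∣≡γGH) , _) =
  ρGγH≤γGH , λ γG _ _ γG≤2kρG → begin
    γG * γH            ≤⟨ *-monoˡ-≤ γH γG≤2kρG ⟩
    2 * k * ρG * γH    ≡⟨ *-assoc (2 * k) ρG γH ⟩
    2 * k * (ρG * γH)  ≤⟨ *-monoʳ-≤ (2 * k) ρGγH≤γGH ⟩
    2 * k * γGH        ∎
  where
  open ≤-Reasoning
  ρGγH≤γGH : ρG * γH ≤ γGH
  ρGγH≤γGH = subst₂ (λ p s → p * γH ≤ s) ∣P∣≡ρG ∣S∣≡γGH
    (packing*γ≤∣S∣ G H S S-dominates δH≥k γH-minimal packing)
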